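{- Let $M=\{1,\dots,m\}$ be partitioned into $M_L$, $M_G$, $M_E$, let $N=\{1,\dots,n\}$, and let $a_{ij}\in\{0,1\}$ ($i\in M$, $j\in N$), $b_i\in\mathbb{Z}_{\ge 0}$ ($i\in M$), $c_j\in\mathbb{R}$ ($j\in N$). Write $S_j=\{i\in M: a_{ij}=1\}$ and, for $\mathbf{x}\in\{0,1\}^n$, $s_i(\mathbf{x})=\sum_{j\in N}a_{ij}x_j$. Let $\widetilde w_i^+\ge 0$ for $i\in M_L\cup M_E$ and $\widetilde w_i^-\ge 0$ for $i\in M_G\cup M_E$, and define $$\tilde z(\mathbf{x})=\sum_{j\in N}c_jx_j+\sum_{i\in M_L\cup M_E}\widetilde w_i^+\,\max\{s_i(\mathbf{x})-b_i,0\}+\sum_{i\in M_G\cup M_E}\widetilde w_i^-\,\max\{b_i-s_i(\mathbf{x}),0\}.$$ Let $\mathbf{x}\in\{0,1\}^n$ be locally optimal with respect to the 1-flip neighborhood, i.e. $\tilde z(\mathbf{x}')\ge \tilde z(\mathbf{x})$ for every $\mathbf{x}'\in\{0,1\}^n$ differing from $\mathbf{x}$ in at most one coordinate. For distinct $j_1,j_2\in N$, let $\Delta\tilde z_{j_1,j_2}(\mathbf{x})=\tilde z(\mathbf{x}'')-\tilde z(\mathbf{x})$, where $\mathbf{x}''$ is obtained from $\mathbf{x}$ by simultaneously replacing $x_{j_1}$ by $1-x_{j_1}$ and $x_{j_2}$ by $1-x_{j_2}$. Then $\Delta\tilde z_{j_1,j_2}(\mathbf{x})<0$ holds only if $S_{j_1}\cap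 S_{j_2}\neq\emptyset$ and $x_{j_1}\neq x_{j_2}$.
   Context: This concerns the binary integer program: minimize $\sum_j c_jx_j$ subject to $\sum_j a_{ij}x_j\le b_i$ ($i\in M_L$), $\sum_j a_{ij}x_j\ge b_i$ ($i\in M_G$), $\sum_j a_{ij}x_j=b_i$ ($i\in M_E$), $x\in\{0,1\}^n$ (which includes set covering and set partitioning). The function $\tilde z$ is the penalized objective in which constraint violations are penalized with the nonnegative weights $\widetilde w_i^{\pm}$.
   Formalization: The values $c_j$ and the penalty weights $\widetilde w_i^+$ and $\widetilde w_i^-$ are rational rather than real. -}

module Defs where

open import Data.Nat using (ℕ; zero; suc; _∸_)
open import Data.Integer using (+_)
open import Data.Bool using (Bool; true; false; not; if_then_else_)
open import Data.Fin using (Fin; zero; suc; _≟_)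
open import Data.Rational using (ℚ; 0ℚ; _+_; _*_; _/_)
open import Relation.Nullary using (does)

-- Kind of a constraint row: M = M_L ⊎ M_G ⊎ M_E is given by a labelling.
data Kind : Set where
  L G E : Kind

sumℚ : (n : ℕ) → (Fin n → ℚ) → ℚ
sumℚ zero    f = 0ℚ
sumℚ (suc n) f = f zero + sumℚ n (λ k → f (suc k))

sumℕ : (n : ℕ) → (Fin n → ℕ) → ℕ
sumℕ zero    f = 0
sumℕ (suc n) f = f zero Data.Nat.+ sumℕ n (λ k → f (suc k))

ℕtoℚ : ℕ → ℚ
ℕtoℚ k = (+ k) / 1

bit : Bool → ℕ
bit true  = 1
bit false = 0

s : {m n : ℕ} → (Fin m → Fin n → Bool) → Fin m → (Fin n → Bool) → ℕ
s {n = n} a i x = sumℕ n (λ j → bit (a i j) Data.Nat.* bit (x j))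

-- does row i penalise excess (i ∈ M_L ∪ M_E) / deficit (i ∈ M_G ∪ M_E)?
inLE : Kind → Bool
inLE L = true
inLE G = false
inLE E = true

inGE : Kind → Bool
inGE L = false
inGE G = true
inGE E = true

-- the penalised objective z̃(x); note max{s-b,0} = s ∸ b on ℕ
ztilde : {m n : ℕ} → (kind : Fin m → Kind) → (a : Fin m → Fin n → Bool)
       → (b : Fin m → ℕ) → (c : Fin n → ℚ) → (w⁺ w⁻ : Fin m → ℚ)
       → (Fin n → Bool) → ℚ
ztilde {m} {n} kind a b c w⁺ w⁻ x =
  sumℚ n (λ j → if x j then c j else 0ℚ)
  + sumℚ m (λ i → if inLE (kind i) then w⁺ i * ℕtoℚ (s a i x ∸ b i) else 0ℚ)
  + sumℚ m (λ i → if inGE (kind i) then w⁻ i * ℕtoℚ (b i ∸ s a i x) else 0ℚ)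

flip : {n : ℕ} → (Fin n → Bool) → Fin n → (Fin n → Bool)
flip x j k = if does (k ≟ j) then not (x k) else x k

{-# OPTIONS --safe #-}
module Submission where

open import Defs
open import Data.Nat using (ℕ)
open import Data.Bool using (Bool; true)
open import Data.Fin using (Fin)
open import Data.Rational using (ℚ; 0ℚ; _≤_; _<_; _-_)
open import Data.Product using (Σ; _×_)
open import Relation.Binary.PropositionalEquality using (_≡_; _≢_)

open import Algebra.Bundles using (CommutativeMonoid)
import Algebra.Properties.CommutativeSemigroup as CommutativeSemigroupProperties
import Algebra.Properties.Group as GroupProperties
open import Data.Bool using (false; not; if_then_else_)
import Data.Bool.Properties as Bool
open import Data.Empty using (⊥-elim)
open import Data.Fin using (zero; suc; _≟_)
open import Data.Fin.Properties using (any?; suc-injective)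
open import Data.Integer as ℤ using (+_)
import Data.Integer.Properties as ℤ
open import Data.Nat as ℕ using (_∸_)
open import Data.Nat.Coprimality using (1-coprimeTo) renaming (sym to coprime-sym)
import Data.Nat.Properties as ℕ
open import Data.Product using (_,_)
open import Data.Rational using (_+_; _*_; -_; _/_; *≤*; nonNegative)
open import Data.Rational.Literals using (fromℤ)
import Data.Rational.Properties as ℚ
open import Data.Sum using (_⊎_; inj₁; inj₂)
open import Function using (_∘_; _$_)
open import Relation.Binary.PropositionalEquality
  using (refl; sym; trans; cong; cong₂; subst; subst₂; module ≡-Reasoning)
open import Relation.Nullary using (¬_; Dec; yes; no)
open import Relation.Nullary.Decidable using (_×-dec_; dec-true; dec-false)

-- Each penalty term of z̃ is a convex function of a row sum s_i, and flipping x_j moves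
-- s_i one step (up if x_j = 0, down if x_j = 1) when i ∈ S_j and leaves it alone
-- otherwise. So unless some row i ∈ S_{j₁} ∩ S_{j₂} sees the two moves cancel, which
-- happens exactly when x_{j₁} ≠ x_{j₂}, z̃ is supermodular along the two flips: the
-- double flip changes z̃ by at least the sum of the two single-flip changes (the cost
-- part and the rows touched by at most one flip are additive, a row moved twice in the
-- same direction is convex). At a 1-flip local optimum both single-flip changes are
-- ≥ 0, so then the double flip cannot improve z̃ either.

flip-≡ : ∀ {n} (x : Fin n → Bool) j → flip x j j ≡ not (x j)
flip-≡ x j = cong (λ b → if b then not (x j) else x j) (dec-true (j ≟ j) refl)

flip-≢ : ∀ {n} (x : Fin n → Bool) {j k} → k ≢ j → flip x j k ≡ x k
flip-≢ x {j} {k} k≢j = cong (λ b → if b then not (x k) else x k) (dec-false (k ≟ j) k≢j)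

flip-pair : ∀ {n} (x : Fin n → Bool) {j₁ j₂} → j₁ ≢ j₂ → ∀ k →
            (flip x j₁ k ≡ flip (flip x j₁) j₂ k × flip x j₂ k ≡ x k)
            ⊎ (flip x j₁ k ≡ x k × flip x j₂ k ≡ flip (flip x j₁) j₂ k)
flip-pair x {j₁} {j₂} j₁≢j₂ k = by-cases (k ≟ j₁) (k ≟ j₂)
  where
  by-cases : Dec (k ≡ j₁) → Dec (k ≡ j₂) →
             (flip x j₁ k ≡ flip (flip x j₁) j₂ k × flip x j₂ k ≡ x k)
             ⊎ (flip x j₁ k ≡ x k × flip x j₂ k ≡ flip (flip x j₁) j₂ k)
  by-cases (yes refl) _ = inj₁ (sym (flip-≢ (flip x j₁) j₁≢j₂) , flip-≢ x j₁≢j₂)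
  by-cases (no k≢j₁) (yes refl) = inj₂ (flip-≢ x k≢j₁ ,
    trans (flip-≡ x k) (sym (trans (flip-≡ (flip x j₁) k) (cong not (flip-≢ x k≢j₁)))))
  by-cases (no k≢j₁) (no k≢j₂) = inj₂ (flip-≢ x k≢j₁ ,
    trans (flip-≢ x k≢j₂) (sym (trans (flip-≢ (flip x j₁) k≢j₂) (flip-≢ x k≢j₁))))

sumℕ-cong : ∀ n {f g : Fin n → ℕ} → (∀ k → f k ≡ g k) → sumℕ n f ≡ sumℕ n g
sumℕ-cong ℕ.zero    f≗g = refl
sumℕ-cong (ℕ.suc n) f≗g = cong₂ ℕ._+_ (f≗g zero) (sumℕ-cong n (f≗g ∘ suc))

sumℕ-exchange : ∀ n (f g : Fin n → ℕ) j → (∀ k → k ≢ j → f k ≡ g k) →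
                f j ℕ.+ sumℕ n g ≡ g j ℕ.+ sumℕ n f
sumℕ-exchange (ℕ.suc n) f g zero f≗g = begin
  f zero ℕ.+ (g zero ℕ.+ Σg) ≡⟨ x∙yz≈y∙xz (f zero) (g zero) Σg ⟩
  g zero ℕ.+ (f zero ℕ.+ Σg) ≡⟨ cong (λ t → g zero ℕ.+ (f zero ℕ.+ t))
                                 (sumℕ-cong n (λ k → sym (f≗g (suc k) λ ()))) ⟩
  g zero ℕ.+ (f zero ℕ.+ Σf) ∎
  where
  open ≡-Reasoning
  open CommutativeSemigroupProperties ℕ.+-commutativeSemigroup
  Σf = sumℕ n (f ∘ suc)
  Σg = sumℕ n (g ∘ suc)
sumℕ-exchange (ℕ.suc n) f g (suc j) f≗g = begin
  f (suc j) ℕ.+ (g zero ℕ.+ Σg) ≡⟨ x∙yz≈y∙xz (f (suc j)) (g zero) Σg ⟩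
  g zero ℕ.+ (f (suc j) ℕ.+ Σg) ≡⟨ cong (g zero ℕ.+_) (sumℕ-exchange n (f ∘ suc) (g ∘ suc) j
                                    λ k k≢j → f≗g (suc k) (k≢j ∘ suc-injective)) ⟩
  g zero ℕ.+ (g (suc j) ℕ.+ Σf) ≡⟨ x∙yz≈y∙xz (g zero) (g (suc j)) Σf ⟩
  g (suc j) ℕ.+ (g zero ℕ.+ Σf) ≡⟨ cong (λ t → g (suc j) ℕ.+ (t ℕ.+ Σf)) (sym (f≗g zero λ ())) ⟩
  g (suc j) ℕ.+ (f zero ℕ.+ Σf) ∎
  where
  open ≡-Reasoning
  open CommutativeSemigroupProperties ℕ.+-commutativeSemigroup
  Σf = sumℕ n (f ∘ suc)
  Σg = sumℕ n (g ∘ suc)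

-- Step p d s t : a flip of a variable with coefficient p and current value d moves a
-- row sum from s to t.
data Step : Bool → Bool → ℕ → ℕ → Set where
  stay : ∀ {d t} → Step false d t t
  up   : ∀ {t} → Step true false t (ℕ.suc t)
  down : ∀ {t} → Step true true (ℕ.suc t) t

step : ∀ p d {s t} → bit p ℕ.* bit d ℕ.+ t ≡ bit p ℕ.* bit (not d) ℕ.+ s → Step p d s t
step false d     refl = stay
step true  false refl = up
step true  true  refl = down

s-flip-step : ∀ {m n} (a : Fin m → Fin n → Bool) i x j →
              Step (a i j) (x j) (s a i x) (s a i (flip x j))
s-flip-step {n = n} a i x j = step (a i j) (x j) (begin
  bit (a i j) ℕ.* bit (x j) ℕ.+ s a i (flip x j)
    ≡⟨ sumℕ-exchange n (λ k → bit (a i k) ℕ.* bit (x k))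
         (λ k → bit (a i k) ℕ.* bit (flip x j k)) j
         (λ k k≢j → cong (λ d → bit (a i k) ℕ.* bit d) (sym (flip-≢ x k≢j))) ⟩
  bit (a i j) ℕ.* bit (flip x j j) ℕ.+ s a i x
    ≡⟨ cong (λ d → bit (a i j) ℕ.* bit d ℕ.+ s a i x) (flip-≡ x j) ⟩
  bit (a i j) ℕ.* bit (not (x j)) ℕ.+ s a i x ∎)
  where open ≡-Reasoning

Convex : (ℕ → ℕ) → Set
Convex f = ∀ t → f (ℕ.suc t) ℕ.+ f (ℕ.suc t) ℕ.≤ f (ℕ.suc (ℕ.suc t)) ℕ.+ f t

∸-convexˡ : ∀ b → Convex (_∸ b)
∸-convexˡ ℕ.zero            t         = ℕ.≤-reflexive (cong ℕ.suc (ℕ.+-suc t t))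
∸-convexˡ (ℕ.suc ℕ.zero)    ℕ.zero    = ℕ.z≤n
∸-convexˡ (ℕ.suc (ℕ.suc b)) ℕ.zero    = ℕ.z≤n
∸-convexˡ (ℕ.suc b)         (ℕ.suc t) = ∸-convexˡ b t

∸-convexʳ : ∀ b → Convex (b ∸_)
∸-convexʳ ℕ.zero            t         = ℕ.z≤n
∸-convexʳ (ℕ.suc ℕ.zero)    ℕ.zero    = ℕ.z≤n
∸-convexʳ (ℕ.suc (ℕ.suc b)) ℕ.zero    = ℕ.≤-reflexive (sym (ℕ.+-suc b (ℕ.suc b)))
∸-convexʳ (ℕ.suc b)         (ℕ.suc t) = ∸-convexʳ b t

convex-steps : ∀ {f} → Convex f → ∀ {p q d₁ d₂ s s₁ s₂ s₁₂} →
               ¬ (p ≡ true × q ≡ true × d₁ ≢ d₂) →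
               Step p d₁ s s₁ → Step q d₂ s s₂ → Step q d₂ s₁ s₁₂ →
               f s₁ ℕ.+ f s₂ ℕ.≤ f s₁₂ ℕ.+ f s
convex-steps     f-convex _    stay stay stay = ℕ.≤-refl
convex-steps {f} f-convex _    stay up   up   = ℕ.≤-reflexive (ℕ.+-comm (f _) _)
convex-steps {f} f-convex _    stay down down = ℕ.≤-reflexive (ℕ.+-comm (f _) _)
convex-steps     f-convex _    up   stay stay = ℕ.≤-refl
convex-steps     f-convex _    down stay stay = ℕ.≤-refl
convex-steps     f-convex _    up   up   up   = f-convex _
convex-steps {f} f-convex _    (down {t = ℕ.suc t}) down down =
  ℕ.≤-trans (f-convex t) (ℕ.≤-reflexive (ℕ.+-comm _ (f t)))
convex-steps     f-convex ¬opp up   down _    = ⊥-elim (¬opp (refl , refl , λ ()))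
convex-steps     f-convex ¬opp down up   _    = ⊥-elim (¬opp (refl , refl , λ ()))

OpposingMoves : ∀ {m n} → (Fin m → Fin n → Bool) → (Fin n → Bool) → Fin n → Fin n → Fin m → Set
OpposingMoves a x j₁ j₂ i = a i j₁ ≡ true × a i j₂ ≡ true × x j₁ ≢ x j₂

convex∘s-flip-pair : ∀ {m n} (f : ℕ → ℕ) → Convex f →
                     (a : Fin m → Fin n → Bool) (i : Fin m) (x : Fin n → Bool) {j₁ j₂ : Fin n} →
                     j₁ ≢ j₂ → ¬ OpposingMoves a x j₁ j₂ i →
                     f (s a i (flip x j₁)) ℕ.+ f (s a i (flip x j₂))
                       ℕ.≤ f (s a i (flip (flip x j₁) j₂)) ℕ.+ f (s a i x)
convex∘s-flip-pair {n = n} f f-convex a i x {j₁} {j₂} j₁≢j₂ ¬opp =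
  convex-steps {f} f-convex ¬opp (s-flip-step a i x j₁) (s-flip-step a i x j₂) step₂-after-step₁
  where
  x₁ x₁₂ : Fin n → Bool
  x₁ = flip x j₁
  x₁₂ = flip x₁ j₂

  step₂-after-step₁ : Step (a i j₂) (x j₂) (s a i x₁) (s a i x₁₂)
  step₂-after-step₁ = subst (λ d → Step (a i j₂) d (s a i x₁) (s a i x₁₂))
                        (flip-≢ x (j₁≢j₂ ∘ sym)) (s-flip-step a i x₁ j₂)

ℕtoℚ≡fromℤ : ∀ k → ℕtoℚ k ≡ fromℤ (+ k)
ℕtoℚ≡fromℤ k = ℚ.normalize-coprime (coprime-sym (1-coprimeTo k))

ℕtoℚ-+ : ∀ a b → ℕtoℚ (a ℕ.+ b) ≡ ℕtoℚ a + ℕtoℚ b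
ℕtoℚ-+ a b = begin
  ℕtoℚ (a ℕ.+ b)                   ≡⟨ cong (_/ 1) (ℤ.pos-+ a b) ⟩
  (+ a ℤ.+ + b) / 1                ≡⟨ cong₂ (λ p q → (p ℤ.+ q) / 1)
                                        (sym (ℤ.*-identityʳ (+ a))) (sym (ℤ.*-identityʳ (+ b))) ⟩
  fromℤ (+ a) + fromℤ (+ b)        ≡⟨ cong₂ _+_ (sym (ℕtoℚ≡fromℤ a)) (sym (ℕtoℚ≡fromℤ b)) ⟩
  ℕtoℚ a + ℕtoℚ b                  ∎
  where open ≡-Reasoning

ℕtoℚ-mono-≤ : ∀ {a b} → a ℕ.≤ b → ℕtoℚ a ≤ ℕtoℚ b
ℕtoℚ-mono-≤ {a} {b} a≤b = subst₂ _≤_ (sym (ℕtoℚ≡fromℤ a)) (sym (ℕtoℚ≡fromℤ b))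
  (*≤* (subst₂ ℤ._≤_ (sym (ℤ.*-identityʳ (+ a))) (sym (ℤ.*-identityʳ (+ b))) (ℤ.+≤+ a≤b)))

weighted-+-mono-≤ : ∀ {w} → 0ℚ ≤ w → ∀ a b c d → a ℕ.+ b ℕ.≤ c ℕ.+ d →
                    w * ℕtoℚ a + w * ℕtoℚ b ≤ w * ℕtoℚ c + w * ℕtoℚ d
weighted-+-mono-≤ {w} 0≤w a b c d a+b≤c+d = begin
  w * ℕtoℚ a + w * ℕtoℚ b  ≡⟨ ℚ.*-distribˡ-+ w (ℕtoℚ a) (ℕtoℚ b) ⟨
  w * (ℕtoℚ a + ℕtoℚ b)    ≡⟨ cong (w *_) (ℕtoℚ-+ a b) ⟨
  w * ℕtoℚ (a ℕ.+ b)       ≤⟨ ℚ.*-monoˡ-≤-nonNeg w {{nonNegative 0≤w}} (ℕtoℚ-mono-≤ a+b≤c+d) ⟩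
  w * ℕtoℚ (c ℕ.+ d)       ≡⟨ cong (w *_) (ℕtoℚ-+ c d) ⟩
  w * (ℕtoℚ c + ℕtoℚ d)    ≡⟨ ℚ.*-distribˡ-+ w (ℕtoℚ c) (ℕtoℚ d) ⟩
  w * ℕtoℚ c + w * ℕtoℚ d  ∎
  where open ℚ.≤-Reasoning

+-cancelʳ-≤ : ∀ r {p q} → p + r ≤ q + r → p ≤ q
+-cancelʳ-≤ r {p} {q} p+r≤q+r = begin
  p            ≡⟨ //-rightDividesʳ r p ⟨
  (p + r) - r  ≤⟨ ℚ.+-monoˡ-≤ (- r) p+r≤q+r ⟩
  (q + r) - r  ≡⟨ //-rightDividesʳ r q ⟩
  q            ∎
  where
  open ℚ.≤-Reasoning
  open GroupProperties ℚ.+-0-group using (//-rightDividesʳ)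

p≤q⇒0≤q-p : ∀ {p q} → p ≤ q → 0ℚ ≤ q - p
p≤q⇒0≤q-p {p} {q} p≤q = subst (_≤ q - p) (ℚ.+-inverseʳ p) (ℚ.+-monoˡ-≤ (- p) p≤q)

record FlipSupermodular {n} (F : (Fin n → Bool) → ℚ) (x : Fin n → Bool) (j₁ j₂ : Fin n) :
                        Set where
  constructor flipSupermodular
  field
    supermodular : F (flip x j₁) + F (flip x j₂) ≤ F (flip (flip x j₁) j₂) + F x

module _ {n : ℕ} (x : Fin n → Bool) {j₁ j₂ : Fin n} where

  +-flipSupermodular : ∀ {F₁ F₂} → FlipSupermodular F₁ x j₁ j₂ → FlipSupermodular F₂ x j₁ j₂ →
                       FlipSupermodular (λ y → F₁ y + F₂ y) x j₁ j₂
  +-flipSupermodular {F₁} {F₂} (flipSupermodular F₁-sm) (flipSupermodular F₂-sm) =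
    flipSupermodular (begin
    (F₁ x₁ + F₂ x₁) + (F₁ x₂ + F₂ x₂)    ≡⟨ interchange (F₁ x₁) (F₂ x₁) (F₁ x₂) (F₂ x₂) ⟩
    (F₁ x₁ + F₁ x₂) + (F₂ x₁ + F₂ x₂)    ≤⟨ ℚ.+-mono-≤ F₁-sm F₂-sm ⟩
    (F₁ x₁₂ + F₁ x) + (F₂ x₁₂ + F₂ x)    ≡⟨ interchange (F₁ x₁₂) (F₁ x) (F₂ x₁₂) (F₂ x) ⟩
    (F₁ x₁₂ + F₂ x₁₂) + (F₁ x + F₂ x)    ∎)
    where
    open ℚ.≤-Reasoning
    open CommutativeSemigroupProperties
           (CommutativeMonoid.commutativeSemigroup ℚ.+-0-commutativeMonoid) using (interchange)
    x₁ = flip x j₁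
    x₂ = flip x j₂
    x₁₂ = flip x₁ j₂

  sumℚ-flipSupermodular : ∀ m (F : Fin m → (Fin n → Bool) → ℚ) →
                          (∀ i → FlipSupermodular (F i) x j₁ j₂) →
                          FlipSupermodular (λ y → sumℚ m (λ i → F i y)) x j₁ j₂
  sumℚ-flipSupermodular ℕ.zero    F F-sm = flipSupermodular ℚ.≤-refl
  sumℚ-flipSupermodular (ℕ.suc m) F F-sm =
    +-flipSupermodular (F-sm zero) (sumℚ-flipSupermodular m (F ∘ suc) (F-sm ∘ suc))

  if-flipSupermodular : ∀ (b : Bool) {F} → (b ≡ true → FlipSupermodular F x j₁ j₂) →
                        FlipSupermodular (λ y → if b then F y else 0ℚ) x j₁ j₂
  if-flipSupermodular true  F-sm = F-sm refl
  if-flipSupermodular false F-sm = flipSupermodular ℚ.≤-refl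

  coordinate-flipSupermodular : j₁ ≢ j₂ → (g : Bool → ℚ) (k : Fin n) →
                                FlipSupermodular (λ y → g (y k)) x j₁ j₂
  coordinate-flipSupermodular j₁≢j₂ g k with flip-pair x j₁≢j₂ k
  ... | inj₁ (x₁≡x₁₂ , x₂≡x) =
    flipSupermodular $ ℚ.≤-reflexive (cong₂ _+_ (cong g x₁≡x₁₂) (cong g x₂≡x))
  ... | inj₂ (x₁≡x , x₂≡x₁₂) =
    flipSupermodular $ ℚ.≤-reflexive
      (trans (ℚ.+-comm (g _) _) (cong₂ _+_ (cong g x₂≡x₁₂) (cong g x₁≡x)))

  penalty-flipSupermodular : ∀ {m} (f : ℕ → ℕ) → Convex f → ∀ {w} → 0ℚ ≤ w →
                             (a : Fin m → Fin n → Bool) (i : Fin m) → j₁ ≢ j₂ →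
                             ¬ OpposingMoves a x j₁ j₂ i →
                             FlipSupermodular (λ y → w * ℕtoℚ (f (s a i y))) x j₁ j₂
  penalty-flipSupermodular f f-convex 0≤w a i j₁≢j₂ ¬opp =
    flipSupermodular $ weighted-+-mono-≤ 0≤w (row (flip x j₁)) (row (flip x j₂))
      (row (flip (flip x j₁) j₂)) (row x) (convex∘s-flip-pair f f-convex a i x j₁≢j₂ ¬opp)
    where
    row : (Fin n → Bool) → ℕ
    row y = f (s a i y)

  flipSupermodular-localMin : ∀ {F} → FlipSupermodular F x j₁ j₂ →
                              F x ≤ F (flip x j₁) → F x ≤ F (flip x j₂) →
                              F x ≤ F (flip (flip x j₁) j₂)
  flipSupermodular-localMin {F} (flipSupermodular F-sm) x≤x₁ x≤x₂ =
    +-cancelʳ-≤ (F x) (ℚ.≤-trans (ℚ.+-mono-≤ x≤x₁ x≤x₂) F-sm)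

ztilde-flipSupermodular : ∀ {m n} (kind : Fin m → Kind) (a : Fin m → Fin n → Bool)
                          (b : Fin m → ℕ) (c : Fin n → ℚ) (w⁺ w⁻ : Fin m → ℚ) →
                          (∀ i → inLE (kind i) ≡ true → 0ℚ ≤ w⁺ i) →
                          (∀ i → inGE (kind i) ≡ true → 0ℚ ≤ w⁻ i) →
                          (x : Fin n → Bool) {j₁ j₂ : Fin n} → j₁ ≢ j₂ →
                          (∀ i → ¬ OpposingMoves a x j₁ j₂ i) →
                          FlipSupermodular (ztilde kind a b c w⁺ w⁻) x j₁ j₂
ztilde-flipSupermodular {m} {n} kind a b c w⁺ w⁻ 0≤w⁺ 0≤w⁻ x j₁≢j₂ ¬opp =
  +-flipSupermodular x (+-flipSupermodular x cost excess) deficit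
  where
  cost = sumℚ-flipSupermodular x n _ λ j →
    coordinate-flipSupermodular x j₁≢j₂ (λ v → if v then c j else 0ℚ) j
  excess = sumℚ-flipSupermodular x m _ λ i → if-flipSupermodular x (inLE (kind i)) λ i∈LE →
    penalty-flipSupermodular x (_∸ b i) (∸-convexˡ (b i)) (0≤w⁺ i i∈LE) a i j₁≢j₂ (¬opp i)
  deficit = sumℚ-flipSupermodular x m _ λ i → if-flipSupermodular x (inGE (kind i)) λ i∈GE →
    penalty-flipSupermodular x (b i ∸_) (∸-convexʳ (b i)) (0≤w⁻ i i∈GE) a i j₁≢j₂ (¬opp i)

lemma1 : (m n : ℕ) (kind : Fin m → Kind) (a : Fin m → Fin n → Bool)
         (b : Fin m → ℕ) (c : Fin n → ℚ) (w⁺ w⁻ : Fin m → ℚ)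
         → (∀ i → inLE (kind i) ≡ true → 0ℚ ≤ w⁺ i)
         → (∀ i → inGE (kind i) ≡ true → 0ℚ ≤ w⁻ i)
         → (x : Fin n → Bool)
         → (∀ (x′ : Fin n → Bool) → Σ (Fin n) (λ j → ∀ k → k ≢ j → x′ k ≡ x k)
            → ztilde kind a b c w⁺ w⁻ x ≤ ztilde kind a b c w⁺ w⁻ x′)
         → (j₁ j₂ : Fin n) → j₁ ≢ j₂
         → ztilde kind a b c w⁺ w⁻ (flip (flip x j₁) j₂) - ztilde kind a b c w⁺ w⁻ x < 0ℚ
         → Σ (Fin m) (λ i → a i j₁ ≡ true × a i j₂ ≡ true) × x j₁ ≢ x j₂
lemma1 m n kind a b c w⁺ w⁻ 0≤w⁺ 0≤w⁻ x locally-optimal j₁ j₂ j₁≢j₂ Δ<0 = shared-row , x₁≢x₂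
  where
  single-flip : ∀ j → ztilde kind a b c w⁺ w⁻ x ≤ ztilde kind a b c w⁺ w⁻ (flip x j)
  single-flip j = locally-optimal (flip x j) (j , λ k → flip-≢ x)

  opposing-row : ¬ (∀ i → ¬ OpposingMoves a x j₁ j₂ i)
  opposing-row ¬opp = ℚ.<-irrefl refl (ℚ.≤-<-trans (p≤q⇒0≤q-p x≤x₁₂) Δ<0)
    where
    x≤x₁₂ = flipSupermodular-localMin x
            (ztilde-flipSupermodular kind a b c w⁺ w⁻ 0≤w⁺ 0≤w⁻ x j₁≢j₂ ¬opp)
            (single-flip j₁) (single-flip j₂)

  shared-row : Σ (Fin m) (λ i → a i j₁ ≡ true × a i j₂ ≡ true)
  shared-row with any? (λ i → (a i j₁ Bool.≟ true) ×-dec (a i j₂ Bool.≟ true))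
  ... | yes row = row
  ... | no ¬row = ⊥-elim (opposing-row λ i (a₁ , a₂ , _) → ¬row (i , a₁ , a₂))

  x₁≢x₂ : x j₁ ≢ x j₂
  x₁≢x₂ x₁≡x₂ = opposing-row λ i (_ , _ , x₁≢x₂) → x₁≢x₂ x₁≡x₂
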